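{- If $t$ and $u$ are strongly extensional trees and there is a tree bisimulation between $t$ and $u$, then $t$ and $u$ are isomorphic.
   Context: A tree is a directed graph $t$ with a distinguished node $\mathrm{root}(t)$ from which every node is reachable by a unique directed path; trees are unordered and isomorphic trees are identified. A tree bisimulation between trees $t$ and $u$ is a relation $R$ between nodes of $t$ and nodes of $u$ such that: (a) whenever $xRy$, every child of $x$ is $R$-related to some child of $y$, and every child of $y$ is $R$-related to some child of $x$; (b) $\mathrm{root}(t)\,R\,\mathrm{root}(u)$, and the roots are not related to any other nodes; (c) whenever two nodes are related, their parents are also related. A tree $t$ is strongly extensional if every tree bisimulation between $t$ and itself is contained in the diagonal $\{(x,x): x\in t\}$. -}

module Defs where

open import Level using (Level; suc; _⊔_)
open import Data.Product using (Σ; _×_; _,_)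
open import Relation.Binary.PropositionalEquality using (_≡_)
open import Function.Bundles using (_↔_; Inverse)

data Path {N : Set} (E : N → N → Set) : N → N → Set where
  []  : ∀ {x} → Path E x x
  _∷_ : ∀ {x y z} → E x y → Path E y z → Path E x z

record Tree : Set₁ where
  field
    Node      : Set
    _⇝_       : Node → Node → Set
    root      : Node
    reach     : ∀ x → Path _⇝_ root x
    reachUniq : ∀ x (p q : Path _⇝_ root x) → p ≡ q

open Tree public

record IsTreeBisim (t u : Tree) (R : Node t → Node u → Set) : Set where
  field
    forth    : ∀ {x y} → R x y → ∀ {x'} → _⇝_ t x x' →
               Σ (Node u) λ y' → _⇝_ u y y' × R x' y'
    back     : ∀ {x y} → R x y → ∀ {y'} → _⇝_ u y y' →
               Σ (Node t) λ x' → _⇝_ t x x' × R x' y'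
    rootRel  : R (root t) (root u)
    rootOnlyˡ : ∀ {y} → R (root t) y → y ≡ root u
    rootOnlyʳ : ∀ {x} → R x (root u) → x ≡ root t
    parents  : ∀ {x y x₀ y₀} → _⇝_ t x₀ x → _⇝_ u y₀ y → R x y → R x₀ y₀

TreeBisim : Tree → Tree → Set₁
TreeBisim t u = Σ (Node t → Node u → Set) (IsTreeBisim t u)

StronglyExtensional : Tree → Set₁
StronglyExtensional t =
  ∀ (R : Node t → Node t → Set) → IsTreeBisim t t R →
  ∀ {x y} → R x y → x ≡ y

record TreeIso (t u : Tree) : Set where
  field
    bij      : Node t ↔ Node u
  open Inverse bij public using (to; from)
  field
    preserve : ∀ {x y} → _⇝_ t x y → _⇝_ u (to x) (to y)
    reflect  : ∀ {x y} → _⇝_ u (to x) (to y) → _⇝_ t x y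
    rootPres : to (root t) ≡ root u

_≅_ : Tree → Tree → Set
t ≅ u = TreeIso t u

{-# OPTIONS --safe #-}
module Submission where

open import Defs
open import Data.Product using (∃; _×_; _,_; proj₁; proj₂)
open import Data.Sum using (_⊎_; inj₁; inj₂)
open import Data.Empty using (⊥-elim)
open import Function using (flip)
open import Function.Bundles using (mk↔ₛ′)
open import Relation.Nullary using (¬_)
open import Relation.Binary.PropositionalEquality using (_≡_; refl; subst)

-- Composing a bisimulation R with its converse gives a tree
-- bisimulation of t (resp. u) with itself, so strong extensionality makes R
-- injective and functional. Pushing the root along paths shows that R is
-- total in both directions, hence R is the graph of a bijection, and the
-- back-and-forth clauses make it an isomorphism.

module _ {N : Set} {E : N → N → Set} where

  infixl 5 _∷ʳ_

  _∷ʳ_ : ∀ {x y z} → Path E x y → E y z → Path E x z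
  []      ∷ʳ e = e ∷ []
  (d ∷ p) ∷ʳ e = d ∷ (p ∷ʳ e)

  []≢∷ʳ : ∀ {x y} (p : Path E x y) (e : E y x) → ¬ ([] ≡ p ∷ʳ e)
  []≢∷ʳ []      e ()
  []≢∷ʳ (_ ∷ _) e ()

  path⇒≡⊎parent : ∀ {x y} → Path E x y → x ≡ y ⊎ ∃ λ z → E z y
  path⇒≡⊎parent []      = inj₁ refl
  path⇒≡⊎parent (e ∷ p) with path⇒≡⊎parent p
  ... | inj₁ refl   = inj₂ (_ , e)
  ... | inj₂ parent = inj₂ parent

root-has-no-parent : (t : Tree) → ∀ {x} → ¬ (_⇝_ t x (root t))
root-has-no-parent t {x} e =
  []≢∷ʳ (reach t x) e (reachUniq t (root t) [] (reach t x ∷ʳ e))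

module _ {t u : Tree} {R : Node t → Node u → Set} (B : IsTreeBisim t u R) where

  open IsTreeBisim B

  related-parent : ∀ {x₀ x y} → _⇝_ t x₀ x → R x y → ∃ λ y₀ → _⇝_ u y₀ y
  related-parent {x₀} {x} {y} e r with path⇒≡⊎parent (reach u y)
  ... | inj₂ parent = parent
  ... | inj₁ refl   = ⊥-elim (root-has-no-parent t (subst (_⇝_ t x₀) (rootOnlyʳ r) e))

  related-total : ∀ x → ∃ (R x)
  related-total x = along (reach t x) (root u , rootRel)
    where
    along : ∀ {a b} → Path (_⇝_ t) a b → ∃ (R a) → ∃ (R b)
    along []      s       = s
    along (e ∷ p) (y , r) = let (y′ , _ , r′) = forth r e in along p (y′ , r′)

  IsTreeBisim-converse : IsTreeBisim u t (flip R)
  IsTreeBisim-converse = record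
    { forth     = back
    ; back      = forth
    ; rootRel   = rootRel
    ; rootOnlyˡ = rootOnlyʳ
    ; rootOnlyʳ = rootOnlyˡ
    ; parents   = λ d e r → parents e d r
    }

IsTreeBisim-compose : ∀ {t u v : Tree} {R : Node t → Node u → Set} {S : Node u → Node v → Set} →
                      IsTreeBisim t u R → IsTreeBisim u v S → IsTreeBisim t v (λ x z → ∃ λ y → R x y × S y z)
IsTreeBisim-compose {R = R} {S} BR BS = record
  { forth     = λ { (y , r , s) e → let (y′ , d , r′) = R.forth r e
                                        (z′ , d′ , s′) = S.forth s d
                                    in z′ , d′ , y′ , r′ , s′ }
  ; back      = λ { (y , r , s) e → let (y′ , d , s′) = S.back s e
                                        (x′ , d′ , r′) = R.back r d
                                    in x′ , d′ , y′ , r′ , s′ }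
  ; rootRel   = _ , R.rootRel , S.rootRel
  ; rootOnlyˡ = λ { (y , r , s) → S.rootOnlyˡ (subst (flip S _) (R.rootOnlyˡ r) s) }
  ; rootOnlyʳ = λ { (y , r , s) → R.rootOnlyʳ (subst (R _) (S.rootOnlyʳ s) r) }
  ; parents   = λ { d d′ (y , r , s) → let (y₀ , e) = related-parent BR d r
                                       in y₀ , R.parents d e r , S.parents e d′ s }
  }
  where
  module R = IsTreeBisim BR
  module S = IsTreeBisim BS

StronglyExtensional⇒injective : ∀ {t u : Tree} {R : Node t → Node u → Set} →
                                IsTreeBisim t u R → StronglyExtensional t →
                                ∀ {x x′ y} → R x y → R x′ y → x ≡ x′
StronglyExtensional⇒injective B se r r′ =
  se _ (IsTreeBisim-compose B (IsTreeBisim-converse B)) (_ , r , r′)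

StronglyExtensional⇒functional : ∀ {t u : Tree} {R : Node t → Node u → Set} →
                                 IsTreeBisim t u R → StronglyExtensional u →
                                 ∀ {x y y′} → R x y → R x y′ → y ≡ y′
StronglyExtensional⇒functional B se =
  StronglyExtensional⇒injective (IsTreeBisim-converse B) se

lemmaA3 : (t u : Tree) → StronglyExtensional t → StronglyExtensional u →
            TreeBisim t u → t ≅ u
lemmaA3 t u se-t se-u (R , B) = record
  { bij      = mk↔ₛ′ to from (λ y → functional (R-to (from y)) (R-from y))
                             (λ x → injective (R-from (to x)) (R-to x))
  ; preserve = λ {x} e → let (_ , e′ , r) = IsTreeBisim.forth B (R-to x) e
                         in subst (_⇝_ u (to x)) (functional r (R-to _)) e′
  ; reflect  = λ {x} e → let (_ , e′ , r) = IsTreeBisim.back B (R-to x) e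
                         in subst (_⇝_ t x) (injective r (R-to _)) e′
  ; rootPres = IsTreeBisim.rootOnlyˡ B (R-to (root t))
  }
  where
  injective : ∀ {x x′ y} → R x y → R x′ y → x ≡ x′
  injective = StronglyExtensional⇒injective B se-t
  functional : ∀ {x y y′} → R x y → R x y′ → y ≡ y′
  functional = StronglyExtensional⇒functional B se-u
  to : Node t → Node u
  to x = proj₁ (related-total B x)
  from : Node u → Node t
  from y = proj₁ (related-total (IsTreeBisim-converse B) y)
  R-to : ∀ x → R x (to x)
  R-to x = proj₂ (related-total B x)
  R-from : ∀ y → R (from y) y
  R-from y = proj₂ (related-total (IsTreeBisim-converse B) y)
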